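{- Let $a_1x_1+\cdots+a_nx_n\leqslant a_0$ be a linear integer constraint with positive integer coefficients $a_1,\dots,a_n$, integer $a_0$, and integer variables $x_i$ with domains $[0,d_i]$, and let $\mathcal M$ be its MDD (with variable order $x_1,\dots,x_n$). Then: (1) the interval of the terminal node $\mathcal T$ is $[0,\infty)$; (2) the interval of the terminal node $\mathcal F$ is $(-\infty,-1]$; (3) if $\nu$ is a node with selector variable $x_i$ and children $\nu_0,\nu_1,\dots,\nu_{d_i}$ (where $\nu_r$ is the child reached when $x_i=r$), and $[\beta_r,\gamma_r]$ is the interval of $\nu_r$ for $0\leqslant r\leqslant d_i$, then the interval of $\nu$ is $[\beta,\gamma]$ with $$\beta=\max\{\beta_r+r a_i : 0\leqslant r\leqslant d_i\},\qquad \gamma=\min\{\gamma_r+r a_i : 0\leqslant r\leqslant d_i\}.$$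
   Context: Integer intervals $[l,u]$ denote $\{k\in\mathbb Z: l\le k\le u\}$ (with $\pm\infty$ allowed as endpoints). The MDD of the constraint is the quasi-reduced ordered multi-valued decision diagram without long edges representing the constraint: it has two terminal nodes $\mathcal T$ (true) and $\mathcal F$ (false); each non-terminal node $\nu$ is labeled by a selector variable $x_i$ and has $d_i+1$ outgoing edges labeled $0,1,\dots,d_i$, leading to nodes with selector variable $x_{i+1}$ (or to terminals if $i=n$); no two distinct nodes root isomorphic sub-diagrams. A node $\nu$ with selector $x_i$ represents the Boolean function $f_\nu$ of $(x_i,\dots,x_n)\in\prod_{k\ge i}[0,d_k]$ defined by $f_\nu(x_i,\dots,x_n)=f_{\nu_{x_i}}(x_{i+1},\dots,x_n)$, where $f_{\mathcal T}\equiv$ true and $f_{\mathcal F}\equiv$ false; the root represents the constraint. The interval of a non-terminal node $\nu$ with selector $x_i$ is the set of integers $\alpha$ such that $f_\nu$ coincides with the constraint $a_ix_i+\cdots+a_nx_n\leqslant\alpha$ on $\prod_{k\ge i}[0,d_k]$; the interval of a terminal node is the set of integers $\alpha$ such that the constant function it represents equals the truth value of $0\leqslant \alpha$. -}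

module Defs where

open import Level using (Lift; lift)
open import Data.Unit using (⊤; tt)
open import Data.Bool using (Bool; true; false)
open import Data.Nat using (ℕ; zero; suc)
open import Data.Fin using (Fin; toℕ) renaming (zero to fzero; suc to fsuc)
open import Data.Integer using (ℤ; +_; _+_; _*_; _≤_; _≤ᵇ_; _⊔_; _⊓_)
open import Data.List using (List; []; _∷_; _++_)
open import Data.Product using (Σ; Σ-syntax; _×_; _,_; proj₁; proj₂)
open import Relation.Binary.PropositionalEquality using (_≡_)

data ℤ∞ : Set where
  -∞  : ℤ∞
  ⟨_⟩ : ℤ → ℤ∞
  +∞  : ℤ∞

data _≤∞_ : ℤ∞ → ℤ∞ → Set where
  -∞≤    : ∀ {x} → -∞ ≤∞ x
  ⟨⟩≤⟨⟩  : ∀ {x y} → x ≤ y → ⟨ x ⟩ ≤∞ ⟨ y ⟩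
  ≤+∞    : ∀ {x} → x ≤∞ +∞

_∈[_,_] : ℤ → ℤ∞ → ℤ∞ → Set
α ∈[ β , γ ] = (β ≤∞ ⟨ α ⟩) × (⟨ α ⟩ ≤∞ γ)

_⊕_ : ℤ∞ → ℤ → ℤ∞
-∞ ⊕ _ = -∞
⟨ x ⟩ ⊕ c = ⟨ x + c ⟩
+∞ ⊕ _ = +∞

max∞ : ℤ∞ → ℤ∞ → ℤ∞
max∞ -∞ y = y
max∞ +∞ y = +∞
max∞ ⟨ x ⟩ -∞ = ⟨ x ⟩
max∞ ⟨ x ⟩ ⟨ y ⟩ = ⟨ x ⊔ y ⟩
max∞ ⟨ x ⟩ +∞ = +∞

min∞ : ℤ∞ → ℤ∞ → ℤ∞
min∞ -∞ y = -∞
min∞ +∞ y = y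
min∞ ⟨ x ⟩ -∞ = -∞
min∞ ⟨ x ⟩ ⟨ y ⟩ = ⟨ x ⊓ y ⟩
min∞ ⟨ x ⟩ +∞ = ⟨ x ⟩

maxOver : (k : ℕ) → (Fin (suc k) → ℤ∞) → ℤ∞
maxOver zero    f = f fzero
maxOver (suc k) f = max∞ (f fzero) (maxOver k (λ r → f (fsuc r)))

minOver : (k : ℕ) → (Fin (suc k) → ℤ∞) → ℤ∞
minOver zero    f = f fzero
minOver (suc k) f = min∞ (f fzero) (minOver k (λ r → f (fsuc r)))

-- Variables: a list of (coefficient a_i , domain bound d_i), in the
-- variable order x_1, …, x_n.  Variable x_i ranges over [0, d_i],
-- represented as Fin (suc d_i).

Vars : Set
Vars = List (ℤ × ℕ)

Assign : Vars → Set
Assign []            = ⊤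
Assign ((a , d) ∷ vs) = Fin (suc d) × Assign vs

lhs : (vs : Vars) → Assign vs → ℤ
lhs []            _        = + 0
lhs ((a , d) ∷ vs) (r , xs) = a * + toℕ r + lhs vs xs

-- Layered (ordered, no long edges) multi-valued decision diagrams.
-- Layers vs : the node layers for the variables vs (top layer first);
-- Vert vs L : the nodes of the top layer (terminals when vs = []).

data Term : Set where
  𝒯 𝓕 : Term

Layers : Vars → Set₁
Vert   : (vs : Vars) → Layers vs → Set

Layers []             = Lift _ ⊤
Layers ((a , d) ∷ vs) =
  Σ[ L ∈ Layers vs ] Σ[ N ∈ Set ] (N → Fin (suc d) → Vert vs L)
Vert []             _           = Term
Vert ((a , d) ∷ vs) (L , N , ch) = N

below : ∀ {a d vs} → Layers ((a , d) ∷ vs) → Layers vs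
below (L , _ , _) = L

child : ∀ {a d vs} (L : Layers ((a , d) ∷ vs)) →
        Vert ((a , d) ∷ vs) L → Fin (suc d) → Vert vs (below {a} {d} {vs} L)
child (L , N , ch) = ch

-- the layers from the selector x_i onwards, where pre = x_1 … x_{i-1}
sub : (pre : Vars) {ws : Vars} → Layers (pre ++ ws) → Layers ws
sub []              L            = L
sub ((a , d) ∷ pre) {ws} (L , _ , _) = sub pre {ws} L

termVal : Term → Bool
termVal 𝒯 = true
termVal 𝓕 = false

eval : (vs : Vars) (L : Layers vs) → Vert vs L → Assign vs → Bool
eval []             _            t _        = termVal t
eval ((a , d) ∷ vs) (L , N , ch) ν (r , xs) = eval vs L (ch ν r) xs

IntervalT : Term → ℤ → Set
IntervalT t α = termVal t ≡ (+ 0 ≤ᵇ α)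

Interval : (vs : Vars) (L : Layers vs) → Vert vs L → ℤ → Set
Interval []            _ t α = IntervalT t α
Interval vs@(_ ∷ _)     L ν α = ∀ xs → eval vs L ν xs ≡ (lhs vs xs ≤ᵇ α)

Iso : (vs : Vars) (L : Layers vs) → Vert vs L → Vert vs L → Set
Iso []             _            t t' = t ≡ t'
Iso ((a , d) ∷ vs) (L , N , ch) ν ν' = ∀ r → Iso vs L (ch ν r) (ch ν' r)

Reduced : (vs : Vars) → Layers vs → Set
Reduced []             _            = ⊤
Reduced ((a , d) ∷ vs) (L , N , ch) =
  (∀ (ν ν' : N) → Iso ((a , d) ∷ vs) (L , N , ch) ν ν' → ν ≡ ν') × Reduced vs L

HasParents : (vs : Vars) → Layers vs → Set
HasParents []                            _ = ⊤
HasParents ((a , d) ∷ [])                _ = ⊤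
HasParents ((a , d) ∷ (a' , d') ∷ vs) (L , N , ch) =
  (∀ (μ : Vert ((a' , d') ∷ vs) L) → Σ[ ν ∈ N ] Σ[ r ∈ Fin (suc d) ] ch ν r ≡ μ)
  × HasParents ((a' , d') ∷ vs) L

RootOnly : (vs : Vars) (L : Layers vs) → Vert vs L → Set
RootOnly []            _ _    = ⊤
RootOnly vs@(_ ∷ _)    L root = ∀ (ν : Vert vs L) → ν ≡ root

record IsMDD (vs : Vars) (a₀ : ℤ) (L : Layers vs) (root : Vert vs L) : Set where
  field
    represents : ∀ xs → eval vs L root xs ≡ (lhs vs xs ≤ᵇ a₀)
    rootOnly   : RootOnly vs L root
    hasParents : HasParents vs L
    reduced    : Reduced vs L

-- Unfolding one layer, f_ν(r, x') = f_{ν_r}(x'), and a_i r + (a_{i+1} x_{i+1} + ⋯) ≤ α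
-- says exactly that the remaining sum is ≤ α - r a_i.  So ν has interval α iff every
-- child ν_r has interval α - r a_i, i.e. iff β_r + r a_i ≤ α ≤ γ_r + r a_i for all r,
-- which is α ∈ [max_r (β_r + r a_i), min_r (γ_r + r a_i)].
module Submission where

open import Defs
open import Data.Nat using (ℕ; suc)
open import Data.Fin using (Fin; toℕ)
open import Data.Integer using (ℤ; +_; _*_; _<_; -1ℤ)
open import Data.List using (List; _∷_; _++_)
open import Data.List.Relation.Unary.All using (All)
open import Data.Product using (_×_; _,_; proj₁)
open import Function.Bundles using (_⇔_)
open import Relation.Binary.PropositionalEquality using (_≡_; subst; sym)

open import Level using (0ℓ)
open import Algebra.Bundles using (AbelianGroup)
open import Data.Bool using (Bool; true; T)
open import Data.Bool.Properties using (T-≡; ⇔→≡)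
open import Data.Nat using (zero; z≤n)
open import Data.Fin using () renaming (zero to fzero; suc to fsuc)
open import Data.Fin.Properties using (∀-cons-⇔)
open import Data.Integer using (_+_; _-_; -_; _≤_; _≤ᵇ_; -[1+_]; +≤+; -≤-)
import Data.Integer.Properties as ℤP
open import Algebra.Properties.Group (AbelianGroup.group ℤP.+-0-abelianGroup)
  using (//-rightDividesˡ; //-rightDividesʳ)
open import Data.List using ([])
open import Data.Product using (proj₂)
open import Data.Product.Function.NonDependent.Propositional using (_×-⇔_)
open import Data.Unit using (tt)
open import Function.Base using (_∘_)
open import Function.Bundles using (mk⇔; module Equivalence)
open import Function.Properties.Equivalence using (⇔-setoid)
  renaming (refl to ⇔-refl; sym to ⇔-sym; trans to ⇔-trans)
open import Relation.Binary.PropositionalEquality using (refl; trans)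

open Equivalence using (to; from)

Π-cong-⇔ : {A : Set} {P Q : A → Set} → (∀ x → P x ⇔ Q x) → (∀ x → P x) ⇔ (∀ x → Q x)
Π-cong-⇔ P⇔Q = mk⇔ (λ p x → to (P⇔Q x) (p x)) (λ q x → from (P⇔Q x) (q x))

Π-distrib-× : {A : Set} {P Q : A → Set} → ((∀ x → P x) × (∀ x → Q x)) ⇔ (∀ x → P x × Q x)
Π-distrib-× = mk⇔ (λ (p , q) x → p x , q x) (λ pq → proj₁ ∘ pq , proj₂ ∘ pq)

T-⇔⇒≡ : {x y : Bool} → T x ⇔ T y → x ≡ y
T-⇔⇒≡ Tx⇔Ty = ⇔→≡ {z = true} (⇔-trans (⇔-sym T-≡) (⇔-trans Tx⇔Ty T-≡))

T-≤ᵇ : {i j : ℤ} → T (i ≤ᵇ j) ⇔ i ≤ j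
T-≤ᵇ = mk⇔ ℤP.≤ᵇ⇒≤ ℤP.≤⇒≤ᵇ

+≤⇔≤- : ∀ x y c → x + c ≤ y ⇔ x ≤ y - c
+≤⇔≤- x y c = mk⇔
  (λ x+c≤y → subst (_≤ y - c) (//-rightDividesʳ c x) (ℤP.+-monoˡ-≤ (- c) x+c≤y))
  (λ x≤y-c → subst (x + c ≤_) (//-rightDividesˡ c y) (ℤP.+-monoˡ-≤ c x≤y-c))

≤+⇔-≤ : ∀ x y c → x ≤ y + c ⇔ x - c ≤ y
≤+⇔-≤ x y c = mk⇔
  (λ x≤y+c → subst (x - c ≤_) (//-rightDividesʳ c y) (ℤP.+-monoˡ-≤ (- c) x≤y+c))
  (λ x-c≤y → subst (_≤ y + c) (//-rightDividesˡ c x) (ℤP.+-monoˡ-≤ c x-c≤y))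

+-≤ᵇ-shift : ∀ c l α → (c + l ≤ᵇ α) ≡ (l ≤ᵇ α - c)
+-≤ᵇ-shift c l α = T-⇔⇒≡ (⇔-trans T-≤ᵇ (⇔-trans comm (⇔-trans (+≤⇔≤- l α c) (⇔-sym T-≤ᵇ))))
  where
  comm : c + l ≤ α ⇔ l + c ≤ α
  comm = mk⇔ (subst (_≤ α) (ℤP.+-comm c l)) (subst (_≤ α) (ℤP.+-comm l c))

⟨⟩-≤∞ : ∀ {x y} → ⟨ x ⟩ ≤∞ ⟨ y ⟩ ⇔ x ≤ y
⟨⟩-≤∞ = mk⇔ (λ { (⟨⟩≤⟨⟩ x≤y) → x≤y }) ⟨⟩≤⟨⟩

⊕-≤∞ : ∀ β c x → (β ⊕ c) ≤∞ ⟨ x ⟩ ⇔ β ≤∞ ⟨ x - c ⟩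
⊕-≤∞ -∞    c x = mk⇔ (λ _ → -∞≤) (λ _ → -∞≤)
⊕-≤∞ ⟨ b ⟩ c x = ⇔-trans ⟨⟩-≤∞ (⇔-trans (+≤⇔≤- b x c) (⇔-sym ⟨⟩-≤∞))
⊕-≤∞ +∞    c x = mk⇔ (λ ()) (λ ())

≤∞-⊕ : ∀ γ c x → ⟨ x ⟩ ≤∞ (γ ⊕ c) ⇔ ⟨ x - c ⟩ ≤∞ γ
≤∞-⊕ -∞    c x = mk⇔ (λ ()) (λ ())
≤∞-⊕ ⟨ g ⟩ c x = ⇔-trans ⟨⟩-≤∞ (⇔-trans (≤+⇔-≤ x g c) (⇔-sym ⟨⟩-≤∞))
≤∞-⊕ +∞    c x = mk⇔ (λ _ → ≤+∞) (λ _ → ≤+∞)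

∈-⊕ : ∀ β γ c α → α ∈[ β ⊕ c , γ ⊕ c ] ⇔ (α - c) ∈[ β , γ ]
∈-⊕ β γ c α = ⊕-≤∞ β c α ×-⇔ ≤∞-⊕ γ c α

max∞-≤∞ : ∀ x y z → max∞ x y ≤∞ z ⇔ (x ≤∞ z × y ≤∞ z)
max∞-≤∞ -∞    y     z = mk⇔ (-∞≤ ,_) proj₂
max∞-≤∞ +∞    y     z = mk⇔ (λ { ≤+∞ → ≤+∞ , ≤+∞ }) proj₁
max∞-≤∞ ⟨ x ⟩ -∞    z = mk⇔ (_, -∞≤) proj₁
max∞-≤∞ ⟨ x ⟩ +∞    z = mk⇔ (λ { ≤+∞ → ≤+∞ , ≤+∞ }) proj₂
max∞-≤∞ ⟨ x ⟩ ⟨ y ⟩ z = mk⇔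
  (λ { (⟨⟩≤⟨⟩ x⊔y≤z) → ⟨⟩≤⟨⟩ (ℤP.i⊔j≤k⇒i≤k x y x⊔y≤z) , ⟨⟩≤⟨⟩ (ℤP.i⊔j≤k⇒j≤k x y x⊔y≤z)
     ; ≤+∞ → ≤+∞ , ≤+∞ })
  (λ { (⟨⟩≤⟨⟩ x≤z , ⟨⟩≤⟨⟩ y≤z) → ⟨⟩≤⟨⟩ (ℤP.⊔-lub x≤z y≤z) ; (≤+∞ , _) → ≤+∞ })

≤∞-min∞ : ∀ x y z → z ≤∞ min∞ x y ⇔ (z ≤∞ x × z ≤∞ y)
≤∞-min∞ +∞    y     z = mk⇔ (≤+∞ ,_) proj₂
≤∞-min∞ -∞    y     z = mk⇔ (λ { -∞≤ → -∞≤ , -∞≤ }) proj₁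
≤∞-min∞ ⟨ x ⟩ +∞    z = mk⇔ (_, ≤+∞) proj₁
≤∞-min∞ ⟨ x ⟩ -∞    z = mk⇔ (λ { -∞≤ → -∞≤ , -∞≤ }) proj₂
≤∞-min∞ ⟨ x ⟩ ⟨ y ⟩ z = mk⇔
  (λ { (⟨⟩≤⟨⟩ z≤x⊓y) → ⟨⟩≤⟨⟩ (ℤP.i≤j⊓k⇒i≤j x y z≤x⊓y) , ⟨⟩≤⟨⟩ (ℤP.i≤j⊓k⇒i≤k x y z≤x⊓y)
     ; -∞≤ → -∞≤ , -∞≤ })
  (λ { (⟨⟩≤⟨⟩ z≤x , ⟨⟩≤⟨⟩ z≤y) → ⟨⟩≤⟨⟩ (ℤP.⊓-glb z≤x z≤y) ; (-∞≤ , _) → -∞≤ })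

maxOver-≤∞ : ∀ d (f : Fin (suc d) → ℤ∞) z → maxOver d f ≤∞ z ⇔ (∀ r → f r ≤∞ z)
maxOver-≤∞ zero    f z = mk⇔ (λ { p fzero → p }) (λ p → p fzero)
maxOver-≤∞ (suc d) f z =
  ⇔-trans (max∞-≤∞ _ _ z) (⇔-trans (⇔-refl ×-⇔ maxOver-≤∞ d (f ∘ fsuc) z) ∀-cons-⇔)

≤∞-minOver : ∀ d (f : Fin (suc d) → ℤ∞) z → z ≤∞ minOver d f ⇔ (∀ r → z ≤∞ f r)
≤∞-minOver zero    f z = mk⇔ (λ { p fzero → p }) (λ p → p fzero)
≤∞-minOver (suc d) f z =
  ⇔-trans (≤∞-min∞ _ _ z) (⇔-trans (⇔-refl ×-⇔ ≤∞-minOver d (f ∘ fsuc) z) ∀-cons-⇔)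

∈-maxOver-minOver : ∀ d (β γ : Fin (suc d) → ℤ∞) α →
  α ∈[ maxOver d β , minOver d γ ] ⇔ (∀ r → α ∈[ β r , γ r ])
∈-maxOver-minOver d β γ α =
  ⇔-trans (maxOver-≤∞ d β ⟨ α ⟩ ×-⇔ ≤∞-minOver d γ ⟨ α ⟩) Π-distrib-×

IntervalT-𝒯 : ∀ α → IntervalT 𝒯 α ⇔ α ∈[ ⟨ + 0 ⟩ , +∞ ]
IntervalT-𝒯 (+ n)    = mk⇔ (λ _ → ⟨⟩≤⟨⟩ (+≤+ z≤n) , ≤+∞) (λ _ → refl)
IntervalT-𝒯 -[1+ n ] = mk⇔ (λ ()) (λ { (⟨⟩≤⟨⟩ () , _) })

IntervalT-𝓕 : ∀ α → IntervalT 𝓕 α ⇔ α ∈[ -∞ , ⟨ -1ℤ ⟩ ]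
IntervalT-𝓕 (+ n)    = mk⇔ (λ ()) (λ { (_ , ⟨⟩≤⟨⟩ ()) })
IntervalT-𝓕 -[1+ n ] = mk⇔ (λ _ → -∞≤ , ⟨⟩≤⟨⟩ (-≤- z≤n)) (λ _ → refl)

-- A terminal is the case of no variables, whose left-hand side is the empty sum 0.
Interval-eval : ∀ ws (L : Layers ws) t α →
  Interval ws L t α ⇔ (∀ xs → eval ws L t xs ≡ (lhs ws xs ≤ᵇ α))
Interval-eval []      L t α = mk⇔ (λ t≡ _ → t≡) (λ t≡ → t≡ tt)
Interval-eval (_ ∷ _) L t α = ⇔-refl

Interval-shift : ∀ ws (L : Layers ws) t c α →
  Interval ws L t (α - c) ⇔ (∀ xs → eval ws L t xs ≡ (c + lhs ws xs ≤ᵇ α))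
Interval-shift ws L t c α = ⇔-trans (Interval-eval ws L t (α - c)) (Π-cong-⇔ λ xs →
  mk⇔ (λ e → trans e (sym (+-≤ᵇ-shift c _ α))) (λ e → trans e (+-≤ᵇ-shift c _ α)))

Interval-children : ∀ {a d ws} (L : Layers ((a , d) ∷ ws)) ν α →
  Interval ((a , d) ∷ ws) L ν α
    ⇔ (∀ r → Interval ws (below {a} {d} {ws} L) (child {a} {d} {ws} L ν r) (α - + toℕ r * a))
Interval-children {a} {d} {ws} (L , N , ch) ν α = mk⇔
  (λ I r → from (shifted r) (λ xs → I (r , xs)))
  (λ I (r , xs) → to (shifted r) (I r) xs)
  where
  shifted : ∀ r → Interval ws L (ch ν r) (α - + toℕ r * a)
                    ⇔ (∀ xs → eval ws L (ch ν r) xs ≡ (a * + toℕ r + lhs ws xs ≤ᵇ α))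
  shifted r rewrite ℤP.*-comm (+ toℕ r) a = Interval-shift ws L (ch ν r) (a * + toℕ r) α

Interval-recurrence : ∀ {a d ws} (L : Layers ((a , d) ∷ ws)) ν (β γ : Fin (suc d) → ℤ∞) →
  (∀ r α → Interval ws (below {a} {d} {ws} L) (child {a} {d} {ws} L ν r) α ⇔ α ∈[ β r , γ r ]) →
  ∀ α → Interval ((a , d) ∷ ws) L ν α
          ⇔ α ∈[ maxOver d (λ r → β r ⊕ (+ toℕ r * a)) , minOver d (λ r → γ r ⊕ (+ toℕ r * a)) ]
Interval-recurrence {a} {d} {ws} L ν β γ child-intervals α = begin
  Interval ((a , d) ∷ ws) L ν α
    ≈⟨ Interval-children L ν α ⟩
  (∀ r → Interval ws (below {a} {d} {ws} L) (child {a} {d} {ws} L ν r) (α - shift r))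
    ≈⟨ Π-cong-⇔ (λ r → child-intervals r (α - shift r)) ⟩
  (∀ r → (α - shift r) ∈[ β r , γ r ])
    ≈⟨ Π-cong-⇔ (λ r → ⇔-sym (∈-⊕ (β r) (γ r) (shift r) α)) ⟩
  (∀ r → α ∈[ β r ⊕ shift r , γ r ⊕ shift r ])
    ≈⟨ ∈-maxOver-minOver d _ _ α ⟨
  α ∈[ maxOver d (λ r → β r ⊕ shift r) , minOver d (λ r → γ r ⊕ shift r) ] ∎
  where
  open import Relation.Binary.Reasoning.Setoid (⇔-setoid 0ℓ)
  shift : Fin (suc d) → ℤ
  shift r = + toℕ r * a

proposition2 : (vs : Vars) (a₀ : ℤ) →
    All (λ v → + 0 < proj₁ v) vs →
    (L : Layers vs) (root : Vert vs L) → IsMDD vs a₀ L root →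
    ((α : ℤ) → IntervalT 𝒯 α ⇔ (α ∈[ ⟨ + 0 ⟩ , +∞ ]))
    × ((α : ℤ) → IntervalT 𝓕 α ⇔ (α ∈[ -∞ , ⟨ -1ℤ ⟩ ]))
    × ((pre : Vars) (a : ℤ) (d : ℕ) (ws : Vars) (e : pre ++ (a , d) ∷ ws ≡ vs) →
       let Lᵢ = sub pre {(a , d) ∷ ws} (subst Layers (sym e) L) in
       (ν : Vert ((a , d) ∷ ws) Lᵢ) (β γ : Fin (suc d) → ℤ∞) →
       ((r : Fin (suc d)) (α : ℤ) →
          Interval ws (below {a} {d} {ws} Lᵢ) (child {a} {d} {ws} Lᵢ ν r) α ⇔ (α ∈[ β r , γ r ])) →
       (α : ℤ) →
       Interval ((a , d) ∷ ws) Lᵢ ν α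
         ⇔ (α ∈[ maxOver d (λ r → β r ⊕ (+ toℕ r * a))
               , minOver d (λ r → γ r ⊕ (+ toℕ r * a)) ]))
-- Neither positivity of the coefficients nor the MDD conditions are needed: the
-- recurrence holds for every node of any layered diagram.
proposition2 vs a₀ _ L root _ =
  IntervalT-𝒯 , IntervalT-𝓕 , λ pre a d ws e → Interval-recurrence _
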